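{- Let $2\le k\le n$. If $\sigma_t$ is a reachable assignment with $\sigma_t^T(o_1)=k$ and $\sigma_t^T(o_n)=k-1$, then $\sigma_t$ is compatible.
   Context: Agents $N=\{1,\dots,n\}$ lie on a path in this order; objects $O=\{o_1,\dots,o_n\}$; each agent $i$ has a strict preference $\succ_i$ (a linear order on $O$); the initial assignment is $\sigma_0(i)=o_i$. A swap exchanges the objects of two adjacent agents and is allowed only if both strictly prefer the object they receive; an assignment is reachable if obtained from $\sigma_0$ by a finite sequence of allowed swaps. $\sigma^T(o)$ is the agent holding $o$ in $\sigma$; $[x,y]$ is the set of integers between $x$ and $y$ inclusive, regardless of order. For an assignment $\sigma_t$ with $\sigma_t^T(o_1)=k$, $\sigma_t^T(o_n)=k-1$ and objects $o_a,o_b$ with $a<b$, put $a'=\sigma_t^T(o_a)$, $b'=\sigma_t^T(o_b)$, $Q=[a,a']\cap[b,b']$. The pair is intersected if $Q\neq\emptyset$. The pair is compatible if it is not intersected, or it is intersected and one of the following holds: (1) $a'>a$, $b'>b$, $a'<b'$ and $o_a\succ_q o_b$ for all $q\in Q$; (2) $a'<a$, $b'<b$, $a'<b'$ and $o_b\succ_q o_a$ for all $q\in Q$; (3) $a'>a$, $b'<b$, $c:=a'+b'-k+1\in Q\setminus\{a\}$, $o_b\succ_q o_a$ for all $\max(a,b')\le q<c$, and $o_a\succ_q o_b$ for all $c\le q\le\min(a',b)$. The assignment $\sigma_t$ is compatible if $\sigma_t(i)\neq o_i$ for every agent $i$ and every pair of objects is compatible. -}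

module Defs where

open import Data.Nat using (ℕ; zero; suc; _+_; _∸_; _≤_; _<_; _⊔_; _⊓_)
open import Data.Fin using (Fin; toℕ; _≟_)
open import Data.Product using (Σ; _×_; _,_)
open import Data.Sum using (_⊎_)
open import Relation.Nullary using (¬_; yes; no)
open import Relation.Binary.PropositionalEquality using (_≡_; _≢_)
open import Relation.Binary.Structures using (IsStrictTotalOrder)

-- Agents and objects are both indexed by Fin n (0-based internally);
-- the paper's 1-based index of agent i / object o_i is  pos i = toℕ i + 1.
pos : {n : ℕ} → Fin n → ℕ
pos i = suc (toℕ i)

-- A preference profile: Pref i x y  means  x ≻_i y  (agent i strictly prefers
-- object x to object y).  Each ≻_i must be a strict linear order on O.
Profile : ℕ → Set₁
Profile n = Fin n → Fin n → Fin n → Set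

IsLinearProfile : {n : ℕ} → Profile n → Set
IsLinearProfile {n} P = (i : Fin n) → IsStrictTotalOrder _≡_ (P i)

-- An assignment maps each agent to the object it holds.
Assignment : ℕ → Set
Assignment n = Fin n → Fin n

σ₀ : {n : ℕ} → Assignment n
σ₀ i = i

swap : {n : ℕ} → Assignment n → Fin n → Fin n → Assignment n
swap σ i j x with x ≟ i
... | yes _ = σ j
... | no _ with x ≟ j
...   | yes _ = σ i
...   | no _ = σ x

-- Assignments are identified up to pointwise equality.
data Reachable {n : ℕ} (P : Profile n) : Assignment n → Set where
  init : (σ : Assignment n) → (∀ x → σ x ≡ σ₀ x) → Reachable P σ
  step : (σ σ' : Assignment n) → Reachable P σ →
         (i j : Fin n) → toℕ j ≡ suc (toℕ i) →
         P i (σ j) (σ i) → P j (σ i) (σ j) →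
         (∀ x → σ' x ≡ swap σ i j x) →
         Reachable P σ'

_∈[_,_] : ℕ → ℕ → ℕ → Set
q ∈[ x , y ] = (x ≤ q × q ≤ y) ⊎ (y ≤ q × q ≤ x)

InQ : ℕ → ℕ → ℕ → ℕ → ℕ → Set
InQ a a' b b' q = q ∈[ a , a' ] × q ∈[ b , b' ]

PairCompatible : {n : ℕ} → Profile n → ℕ →
                 (oa ob ha hb : Fin n) → Set
PairCompatible {n} P k oa ob ha hb =
    (¬ Σ (Fin n) (λ q → InQ a a' b b' (pos q)))
  ⊎ ( (a < a' × b < b' × a' < b' ×
        ((q : Fin n) → InQ a a' b b' (pos q) → P q oa ob))
    ⊎ ( (a' < a × b' < b × a' < b' ×
          ((q : Fin n) → InQ a a' b b' (pos q) → P q ob oa))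
      ⊎ (a < a' × b' < b ×
          InQ a a' b b' c × c ≢ a ×
          ((q : Fin n) → (a ⊔ b') ≤ pos q → pos q < c → P q ob oa) ×
          ((q : Fin n) → c ≤ pos q → pos q ≤ (a' ⊓ b) → P q oa ob))))
  where
    a = pos oa
    b = pos ob
    a' = pos ha
    b' = pos hb
    -- c = a' + b' - k + 1; if this integer is ≤ 0 the truncation gives 0,
    -- which lies outside Q ⊆ [1,n], exactly as the integer value would.
    c = (a' + b' + 1) ∸ k

-- Since σ is a bijection,
-- σ^T(o) is the unique agent h with σ h ≡ o; we quantify over the holders.
Compatible : {n : ℕ} → Profile n → ℕ → Assignment n → Set
Compatible {n} P k σ =
  ((i : Fin n) → σ i ≢ i) ×
  ((ha hb : Fin n) → pos (σ ha) < pos (σ hb) →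
     PairCompatible P k (σ ha) (σ hb) ha hb)

-- Agents only ever trade up. Hence, in a reachable assignment, an agent prefers its current
-- object to every object that has passed through it and, of two objects that passed through it
-- in the same direction, it prefers the later one. Two objects that have crossed were swapped by
-- a pair of adjacent agents, the meeting point, and the meeting point can be recovered by
-- counting the leftward-moving objects held between their current holders.
-- If o₁ is at agent k and oₙ at agent k − 1, then every agent left of k holds an object that
-- moved left and every other agent one that moved right. The count is then k − 1 − b′, so a
-- crossing pair met exactly at c = a′ + b′ + 1 − k, which is condition (3).

module Submission where

open import Defs
open import Data.Nat using (ℕ; zero; suc; _+_; _∸_; _≤_; _<_; _⊔_; _⊓_; z≤n; s≤s; z<s; s≤s⁻¹)
open import Data.Nat.Properties
open import Data.Fin as Fin using (Fin; fromℕ<)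
open import Data.Fin.Properties using (toℕ-injective; toℕ-fromℕ<; toℕ<n; punchInᵢ≢i)
import Data.Fin.Permutation as Permutation
open import Data.Fin.Permutation.Components using (transpose)
open import Data.Product using (_×_; _,_; proj₁; proj₂)
open import Data.Sum using (_⊎_; inj₁; inj₂) renaming (swap to ⊎-swap)
open import Data.Empty using (⊥-elim)
open import Function using (_∘_; _⇔_; mk⇔; Equivalence)
import Function.Properties.Equivalence
open import Relation.Nullary using (Dec; yes; no; ¬_; contradiction)
open import Relation.Binary.Structures using (IsStrictTotalOrder)
open import Relation.Binary.Definitions using (tri<; tri≈; tri>)
open import Relation.Nullary.Decidable using (_×-dec_; dec-true; dec-false)
open import Relation.Binary.PropositionalEquality
open import Data.Nat.Solver using (module +-*-Solver)
open import Algebra.Properties.CommutativeMonoid.Sum +-0-commutativeMonoid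
  using (sum; sum-cong-≗; sum-remove; sum-permute; sum-replicate-zero)

open Equivalence using (to; from)
open +-*-Solver using (solve; _:+_; con; _:=_)

pos-injective : ∀ {n} {a b : Fin n} → pos a ≡ pos b → a ≡ b
pos-injective = toℕ-injective ∘ suc-injective

module _ {n} (i j : Fin n) where

  transpose-matchˡ : transpose i j i ≡ j
  transpose-matchˡ rewrite dec-true (i Fin.≟ i) refl = refl

  transpose-matchʳ : transpose i j j ≡ i
  transpose-matchʳ with j Fin.≟ i
  ... | yes j≡i = j≡i
  ... | no _ rewrite dec-true (j Fin.≟ j) refl = refl

  transpose-other : ∀ {k} → k ≢ i → k ≢ j → transpose i j k ≡ k
  transpose-other {k} k≢i k≢j rewrite dec-false (k Fin.≟ i) k≢i | dec-false (k Fin.≟ j) k≢j = refl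

data TransposeView {n} (i j : Fin n) : Fin n → Set where
  at-i : transpose i j i ≡ j → TransposeView i j i
  at-j : transpose i j j ≡ i → TransposeView i j j
  away : ∀ {k} → k ≢ i → k ≢ j → transpose i j k ≡ k → TransposeView i j k

transposeView : ∀ {n} (i j k : Fin n) → TransposeView i j k
transposeView i j k with k Fin.≟ i | k Fin.≟ j
... | yes refl | _ = at-i (transpose-matchˡ i j)
... | no _ | yes refl = at-j (transpose-matchʳ i j)
... | no k≢i | no k≢j = away k≢i k≢j (transpose-other i j k≢i k≢j)

swap≗transpose : ∀ {n} (σ : Assignment n) i j x → swap σ i j x ≡ σ (transpose i j x)
swap≗transpose σ i j x with x Fin.≟ i
... | yes _ = refl
... | no _ with x Fin.≟ j
...   | yes _ = refl
...   | no _ = refl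

indicator : {A : Set} → Dec A → ℕ
indicator (yes _) = 1
indicator (no _) = 0

indicator-yes : {A : Set} (a? : Dec A) → A → indicator a? ≡ 1
indicator-yes (yes _) _ = refl
indicator-yes (no ¬a) a = contradiction a ¬a

indicator-no : {A : Set} (a? : Dec A) → ¬ A → indicator a? ≡ 0
indicator-no (yes a) ¬a = contradiction a ¬a
indicator-no (no _) _ = refl

indicator-cong : {A B : Set} (a? : Dec A) (b? : Dec B) → A ⇔ B → indicator a? ≡ indicator b?
indicator-cong (yes _) (yes _) _ = refl
indicator-cong (no _) (no _) _ = refl
indicator-cong (yes a) (no ¬b) A⇔B = contradiction (to A⇔B a) ¬b
indicator-cong (no ¬a) (yes b) A⇔B = contradiction (from A⇔B b) ¬a

count : ∀ {n} {P : Fin n → Set} → (∀ q → Dec (P q)) → ℕ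
count P? = sum (indicator ∘ P?)

module _ {n} {P Q : Fin n → Set} (P? : ∀ q → Dec (P q)) (Q? : ∀ q → Dec (Q q)) where

  count-cong : (∀ q → P q ⇔ Q q) → count P? ≡ count Q?
  count-cong P⇔Q = sum-cong-≗ λ q → indicator-cong (P? q) (Q? q) (P⇔Q q)

  count-transpose : ∀ i j → (∀ q → q ≢ i → q ≢ j → P q ⇔ Q q) → P i ⇔ Q j → P j ⇔ Q i →
                    count P? ≡ count Q?
  count-transpose i j P⇔Q Pi⇔Qj Pj⇔Qi = begin
    count P?                   ≡⟨ sum-permute (indicator ∘ P?) (Permutation.transpose i j) ⟩
    count (P? ∘ transpose i j) ≡⟨ sum-cong-≗ (λ q → reindex q (transposeView i j q)) ⟩
    count Q?                   ∎
    where
    open ≡-Reasoning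
    reindex : ∀ q → TransposeView i j q → indicator (P? (transpose i j q)) ≡ indicator (Q? q)
    reindex q (at-i τi) rewrite τi = indicator-cong (P? j) (Q? i) Pj⇔Qi
    reindex q (at-j τj) rewrite τj = indicator-cong (P? i) (Q? j) Pi⇔Qj
    reindex q (away q≢i q≢j τq) rewrite τq = indicator-cong (P? q) (Q? q) (P⇔Q q q≢i q≢j)

count-insert : ∀ {n} {P Q : Fin n → Set} (P? : ∀ q → Dec (P q)) (Q? : ∀ q → Dec (Q q)) i →
               (∀ q → q ≢ i → P q ⇔ Q q) → ¬ P i → Q i → count Q? ≡ suc (count P?)
count-insert {suc n} P? Q? i P⇔Q ¬Pi Qi = begin
  count Q?                            ≡⟨ sum-remove (indicator ∘ Q?) ⟩
  indicator (Q? i) + count (Q? ∘ ι)   ≡⟨ cong₂ _+_ (indicator-yes (Q? i) Qi) (sym punched) ⟩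
  suc (count (P? ∘ ι))                ≡⟨ cong (λ m → suc (m + count (P? ∘ ι))) (sym (indicator-no (P? i) ¬Pi)) ⟩
  suc (indicator (P? i) + count (P? ∘ ι)) ≡⟨ cong suc (sym (sum-remove (indicator ∘ P?))) ⟩
  suc (count P?)                      ∎
  where
  open ≡-Reasoning
  ι : Fin n → Fin (suc n)
  ι = Fin.punchIn i
  punched : count (P? ∘ ι) ≡ count (Q? ∘ ι)
  punched = count-cong (P? ∘ ι) (Q? ∘ ι) (λ q → P⇔Q (ι q) (punchInᵢ≢i i q))

count-none : ∀ {n} {P : Fin n → Set} (P? : ∀ q → Dec (P q)) → (∀ q → ¬ P q) → count P? ≡ 0
count-none {n} P? ¬P = trans (sum-cong-≗ λ q → indicator-no (P? q) (¬P q)) (sum-replicate-zero n)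

in-interval? : ∀ {n} lo hi (q : Fin n) → Dec (lo < pos q × pos q ≤ hi)
in-interval? lo hi q = lo <? pos q ×-dec pos q ≤? hi

count-interval : ∀ n lo hi → hi ≤ n → count (in-interval? {n} lo hi) ≡ hi ∸ lo
count-interval n lo zero _ = trans (count-none (in-interval? {n} lo 0) λ { _ (_ , ()) }) (sym (0∸n≡0 lo))
count-interval (suc n) zero (suc hi) (s≤s hi≤n) =
  cong₂ _+_ (indicator-yes (in-interval? {suc n} 0 (suc hi) Fin.zero) (z<s , s≤s z≤n))
            (trans (count-cong (in-interval? 0 (suc hi) ∘ Fin.suc {n}) (in-interval? 0 hi)
                     λ _ → mk⇔ (λ (_ , q≤hi) → z<s , s≤s⁻¹ q≤hi) (λ (_ , q≤hi) → z<s , s≤s q≤hi))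
                   (count-interval n zero hi hi≤n))
count-interval (suc n) (suc lo) (suc hi) (s≤s hi≤n) =
  cong₂ _+_ (indicator-no (in-interval? {suc n} (suc lo) (suc hi) Fin.zero) λ { (s≤s () , _) })
            (trans (count-cong (in-interval? (suc lo) (suc hi) ∘ Fin.suc {n}) (in-interval? lo hi)
                     λ _ → mk⇔ (λ (lo<q , q≤hi) → s≤s⁻¹ lo<q , s≤s⁻¹ q≤hi)
                               (λ (lo<q , q≤hi) → s≤s lo<q , s≤s q≤hi))
                   (count-interval n lo hi hi≤n))

x+m+b+1≡x+[1+b+m] : ∀ x m b → x + m + b + 1 ≡ x + suc (b + m)
x+m+b+1≡x+[1+b+m] = solve 3 (λ x m b → x :+ m :+ b :+ con 1 := x :+ (con 1 :+ (b :+ m))) refl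

∈[]-bounds : ∀ {x y q} → x ≤ y → q ∈[ x , y ] → x ≤ q × q ≤ y
∈[]-bounds _ (inj₁ x≤q≤y) = x≤q≤y
∈[]-bounds x≤y (inj₂ (y≤q , q≤x)) = ≤-trans x≤y y≤q , ≤-trans q≤x x≤y

∈[]-boundsᵒ : ∀ {x y q} → y ≤ x → q ∈[ x , y ] → y ≤ q × q ≤ x
∈[]-boundsᵒ y≤x = ∈[]-bounds y≤x ∘ ⊎-swap

both-false : {A B : Set} → ¬ A → ¬ B → A ⇔ B
both-false ¬a ¬b = mk⇔ (λ a → contradiction a ¬a) (λ b → contradiction b ¬b)

-- Object o_m starts at agent m, so this is where the object now held by h started.
home : ∀ {n} → Assignment n → Fin n → ℕ
home σ h = pos (σ h)

Passed : ∀ {n} → Assignment n → Fin n → ℕ → Set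
Passed σ h q = (home σ h ≤ q × q < pos h) ⊎ (pos h < q × q ≤ home σ h)

MovedLeft MovedRight : ∀ {n} → Assignment n → Fin n → Set
MovedLeft σ h = pos h < home σ h
MovedRight σ h = home σ h < pos h

SplitAt : ∀ {n} → Assignment n → ℕ → Set
SplitAt σ k = (∀ h → pos h < k → MovedLeft σ h) × (∀ h → k ≤ pos h → MovedRight σ h)

MovedLeftBetween : ∀ {n} → Assignment n → ℕ → ℕ → Fin n → Set
MovedLeftBetween σ lo hi q = lo < pos q × pos q < hi × MovedLeft σ q

movedLeftBetween? : ∀ {n} σ lo hi (q : Fin n) → Dec (MovedLeftBetween σ lo hi q)
movedLeftBetween? σ lo hi q = lo <? pos q ×-dec pos q <? hi ×-dec pos q <? home σ q

#movedLeft : ∀ {n} → Assignment n → ℕ → ℕ → ℕ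
#movedLeft σ lo hi = count (movedLeftBetween? σ lo hi)

module _ {n} (P : Profile n) (linear : IsLinearProfile P) where

  private
    module ≻ q = IsStrictTotalOrder (linear q)

  -- x moved right to agent px, y moved left to agent py, and they were swapped by the agents meet
  -- and meet + 1; every later step of x to the right put an object moving left between py and px.
  record Crossing (σ : Assignment n) (x y : Fin n) (px py : ℕ) : Set where
    field
      meet                  : ℕ
      x-home≤meet           : pos x ≤ meet
      meet<px               : meet < px
      py≤meet               : py ≤ meet
      meet<y-home           : meet < pos y
      y≻x-up-to-meet        : ∀ q → py ≤ pos q → pos q ≤ meet → pos x ≤ pos q → P q y x
      x≻y-after-meet        : ∀ q → meet < pos q → pos q ≤ px → pos q ≤ pos y → P q x y
      away-from-home        : ∀ q → py < pos q → pos q < px → pos q ≢ home σ q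
      px≡meet+1+#movedLeft  : px ≡ suc meet + #movedLeft σ py px

  crossing-directions : ∀ {σ x y px py} → Crossing σ x y px py → pos x < px × py < pos y
  crossing-directions C = ≤-<-trans x-home≤meet meet<px , ≤-<-trans py≤meet meet<y-home
    where open Crossing C

  record Invariant (σ : Assignment n) : Set where
    field
      current≻passed   : ∀ q h → Passed σ h (pos q) → P q (σ q) (σ h)
      follower≻leaderʳ : ∀ ha hb q → home σ ha < home σ hb → pos ha < pos hb →
                         home σ hb ≤ pos q → pos q ≤ pos ha → P q (σ ha) (σ hb)
      follower≻leaderˡ : ∀ ha hb q → home σ ha < home σ hb → pos ha < pos hb →
                         pos hb ≤ pos q → pos q ≤ home σ ha → P q (σ hb) (σ ha)
      crossing         : ∀ ha hb → home σ ha < home σ hb → pos hb < pos ha →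
                         Crossing σ (σ ha) (σ hb) (pos ha) (pos hb)

  module _ {σ σ′ : Assignment n} (σ≗σ′ : ∀ x → σ x ≡ σ′ x) where

    crossing-resp-≗ : ∀ {x y px py} → Crossing σ x y px py → Crossing σ′ x y px py
    crossing-resp-≗ C = record
      { Crossing C
      ; away-from-home       = λ q b<q q<a → subst (pos q ≢_) (cong pos (σ≗σ′ q)) (away-from-home q b<q q<a)
      ; px≡meet+1+#movedLeft = trans px≡meet+1+#movedLeft (cong (suc meet +_) (count-cong _ _ same))
      }
      where
      open Crossing C
      same : ∀ q → MovedLeftBetween σ _ _ q ⇔ MovedLeftBetween σ′ _ _ q
      same q rewrite σ≗σ′ q = Function.Properties.Equivalence.refl

    invariant-resp-≗ : Invariant σ → Invariant σ′
    invariant-resp-≗ inv = record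
      { current≻passed   = current≻passed′
      ; follower≻leaderʳ = follower≻leaderʳ′
      ; follower≻leaderˡ = follower≻leaderˡ′
      ; crossing         = crossing′
      }
      where
      open Invariant inv
      current≻passed′ : ∀ q h → Passed σ′ h (pos q) → P q (σ′ q) (σ′ h)
      current≻passed′ q h rewrite sym (σ≗σ′ q) | sym (σ≗σ′ h) = current≻passed q h
      follower≻leaderʳ′ : ∀ ha hb q → home σ′ ha < home σ′ hb → pos ha < pos hb →
                          home σ′ hb ≤ pos q → pos q ≤ pos ha → P q (σ′ ha) (σ′ hb)
      follower≻leaderʳ′ ha hb rewrite sym (σ≗σ′ ha) | sym (σ≗σ′ hb) = follower≻leaderʳ ha hb
      follower≻leaderˡ′ : ∀ ha hb q → home σ′ ha < home σ′ hb → pos ha < pos hb →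
                          pos hb ≤ pos q → pos q ≤ home σ′ ha → P q (σ′ hb) (σ′ ha)
      follower≻leaderˡ′ ha hb rewrite sym (σ≗σ′ ha) | sym (σ≗σ′ hb) = follower≻leaderˡ ha hb
      crossing′ : ∀ ha hb → home σ′ ha < home σ′ hb → pos hb < pos ha →
                  Crossing σ′ (σ′ ha) (σ′ hb) (pos ha) (pos hb)
      crossing′ ha hb rewrite sym (σ≗σ′ ha) | sym (σ≗σ′ hb) =
        λ a<b b<a → crossing-resp-≗ (crossing ha hb a<b b<a)

  initial-invariant : Invariant σ₀
  initial-invariant = record
    { current≻passed   = λ { _ _ (inj₁ (h≤q , q<h)) → contradiction q<h (≤⇒≯ h≤q)
                           ; _ _ (inj₂ (h<q , q≤h)) → contradiction h<q (≤⇒≯ q≤h) }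
    ; follower≻leaderʳ = λ _ _ _ _ a<b b≤q q≤a → contradiction a<b (≤⇒≯ (≤-trans b≤q q≤a))
    ; follower≻leaderˡ = λ _ _ _ _ a<b b≤q q≤a → contradiction a<b (≤⇒≯ (≤-trans b≤q q≤a))
    ; crossing         = λ _ _ a<b b<a → contradiction a<b (<⇒≯ b<a)
    }

  module Step {σ : Assignment n} (inv : Invariant σ) {i j : Fin n} (j≡i+1 : pos j ≡ suc (pos i))
              (i-gains : P i (σ j) (σ i)) (j-gains : P j (σ i) (σ j)) where

    open Invariant inv

    τ : Fin n → Fin n
    τ = transpose i j

    σ′ : Assignment n
    σ′ = σ ∘ τ

    i<j : pos i < pos j
    i<j = subst (pos i <_) (sym j≡i+1) (n<1+n (pos i))

    <j⇒≤i : ∀ {m} → m < pos j → m ≤ pos i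
    <j⇒≤i {m} m<j = s≤s⁻¹ (subst (m <_) j≡i+1 m<j)

    i<⇒j≤ : ∀ {m} → pos i < m → pos j ≤ m
    i<⇒j≤ {m} = subst (_≤ m) (sym j≡i+1)

    i-home≤i : home σ i ≤ pos i
    i-home≤i = ≮⇒≥ λ i<home → ≻.asym j j-gains (current≻passed j i (inj₂ (i<j , i<⇒j≤ i<home)))

    j≤j-home : pos j ≤ home σ j
    j≤j-home = ≮⇒≥ λ home<j → ≻.asym i i-gains (current≻passed i j (inj₁ (<j⇒≤i home<j , i<j)))

    trade-up : ∀ q {z} → P q (σ q) z → P q (σ′ q) z
    trade-up q q-prefers with transposeView i j q
    ... | at-i τi rewrite τi = ≻.trans i i-gains q-prefers
    ... | at-j τj rewrite τj = ≻.trans j j-gains q-prefers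
    ... | away _ _ τq rewrite τq = q-prefers

    current≻passed′ : ∀ q h → Passed σ′ h (pos q) → P q (σ′ q) (σ′ h)
    current≻passed′ q h passed with transposeView i j h
    current≻passed′ q h passed | away _ _ τh rewrite τh = trade-up q (current≻passed q h passed)
    current≻passed′ q h (inj₁ (home≤q , q<j)) | at-j τj rewrite τj with m≤n⇒m<n∨m≡n (<j⇒≤i q<j)
    ... | inj₁ q<i = trade-up q (current≻passed q i (inj₁ (home≤q , q<i)))
    ... | inj₂ q≡i with refl ← pos-injective q≡i rewrite transpose-matchˡ i j = i-gains
    current≻passed′ q h (inj₂ (j<q , q≤home)) | at-j τj rewrite τj =
      contradiction (≤-trans q≤home i-home≤i) (<⇒≱ (<-trans i<j j<q))
    current≻passed′ q h (inj₁ (home≤q , q<i)) | at-i τi rewrite τi =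
      contradiction (≤-trans j≤j-home home≤q) (<⇒≱ (<-trans q<i i<j))
    current≻passed′ q h (inj₂ (i<q , q≤home)) | at-i τi rewrite τi with m≤n⇒m<n∨m≡n (i<⇒j≤ i<q)
    ... | inj₁ j<q = trade-up q (current≻passed q j (inj₂ (j<q , q≤home)))
    ... | inj₂ j≡q with refl ← pos-injective j≡q rewrite transpose-matchʳ i j = j-gains

    τ-preserves-< : ∀ {a b} → pos a < pos b → (a ≡ i × b ≡ j) ⊎ pos (τ a) < pos (τ b)
    τ-preserves-< {a} {b} a<b with transposeView i j a | transposeView i j b
    ... | at-i _  | at-i _ = contradiction a<b (<-irrefl refl)
    ... | at-i _  | at-j _ = inj₁ (refl , refl)
    ... | at-i τi | away _ b≢j τb rewrite τi | τb = inj₂ (≤∧≢⇒< (i<⇒j≤ a<b) (b≢j ∘ pos-injective ∘ sym))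
    ... | at-j _  | at-i _ = contradiction a<b (<-asym i<j)
    ... | at-j _  | at-j _ = contradiction a<b (<-irrefl refl)
    ... | at-j τj | away _ _ τb rewrite τj | τb = inj₂ (<-trans i<j a<b)
    ... | away _ _ τa | at-i τi rewrite τa | τi = inj₂ (<-trans a<b i<j)
    ... | away a≢i _ τa | at-j τj rewrite τa | τj = inj₂ (≤∧≢⇒< (<j⇒≤i a<b) (a≢i ∘ pos-injective))
    ... | away _ _ τa | away _ _ τb rewrite τa | τb = inj₂ a<b

    order-kept : ∀ {a b} → home σ′ a < home σ′ b → pos a < pos b → pos (τ a) < pos (τ b)
    order-kept home< a<b with τ-preserves-< a<b
    ... | inj₂ τa<τb = τa<τb
    ... | inj₁ (refl , refl) rewrite transpose-matchˡ i j | transpose-matchʳ i j =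
      contradiction home< (≤⇒≯ (≤-trans i-home≤i (≤-trans (<⇒≤ i<j) j≤j-home)))

    follower≻leaderʳ′ : ∀ ha hb q → home σ′ ha < home σ′ hb → pos ha < pos hb →
                        home σ′ hb ≤ pos q → pos q ≤ pos ha → P q (σ′ ha) (σ′ hb)
    follower≻leaderʳ′ ha hb q home< a<b b-home≤q q≤a with order-kept home< a<b | transposeView i j ha
    ... | kept | away _ _ τa rewrite τa = follower≻leaderʳ ha (τ hb) q home< kept b-home≤q q≤a
    ... | kept | at-i τi rewrite τi =
      follower≻leaderʳ j (τ hb) q home< kept b-home≤q (≤-trans q≤a (<⇒≤ i<j))
    ... | kept | at-j τj rewrite τj with m≤n⇒m<n∨m≡n q≤a
    ...   | inj₁ q<j = follower≻leaderʳ i (τ hb) q home< kept b-home≤q (<j⇒≤i q<j)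
    ...   | inj₂ q≡j with refl ← pos-injective q≡j | transposeView i j hb
    ...     | at-i _ = contradiction a<b (<-asym i<j)
    ...     | at-j _ = contradiction a<b (<-irrefl refl)
    ...     | away _ _ τb rewrite τb = ≻.trans j j-gains (current≻passed j hb (inj₁ (b-home≤q , a<b)))

    follower≻leaderˡ′ : ∀ ha hb q → home σ′ ha < home σ′ hb → pos ha < pos hb →
                        pos hb ≤ pos q → pos q ≤ home σ′ ha → P q (σ′ hb) (σ′ ha)
    follower≻leaderˡ′ ha hb q home< a<b b≤q q≤a-home with order-kept home< a<b | transposeView i j hb
    ... | kept | away _ _ τb rewrite τb = follower≻leaderˡ (τ ha) hb q home< kept b≤q q≤a-home
    ... | kept | at-j τj rewrite τj =
      follower≻leaderˡ (τ ha) i q home< kept (≤-trans (<⇒≤ i<j) b≤q) q≤a-home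
    ... | kept | at-i τi rewrite τi with m≤n⇒m<n∨m≡n b≤q
    ...   | inj₁ i<q = follower≻leaderˡ (τ ha) j q home< kept (i<⇒j≤ i<q) q≤a-home
    ...   | inj₂ i≡q with refl ← pos-injective (sym i≡q) | transposeView i j ha
    ...     | at-i _ = contradiction a<b (<-irrefl refl)
    ...     | at-j _ = contradiction a<b (<-asym i<j)
    ...     | away _ _ τa rewrite τa = ≻.trans i i-gains (current≻passed i ha (inj₂ (a<b , q≤a-home)))

    i-moved-left′ : MovedLeft σ′ i
    i-moved-left′ rewrite transpose-matchˡ i j = <-≤-trans i<j j≤j-home

    j-moved-right′ : MovedRight σ′ j
    j-moved-right′ rewrite transpose-matchʳ i j = ≤-<-trans i-home≤i i<j

    away-from-home′ : ∀ q → (q ≢ i → q ≢ j → pos q ≢ home σ q) → pos q ≢ home σ′ q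
    away-from-home′ q stays with transposeView i j q
    ... | at-i _ = <⇒≢ i-moved-left′
    ... | at-j _ = >⇒≢ j-moved-right′
    ... | away q≢i q≢j τq rewrite τq = stays q≢i q≢j

    new-crossing : Crossing σ′ (σ i) (σ j) (pos j) (pos i)
    new-crossing = record
      { meet                 = pos i
      ; x-home≤meet          = i-home≤i
      ; meet<px              = i<j
      ; py≤meet              = ≤-refl
      ; meet<y-home          = <-≤-trans i<j j≤j-home
      ; y≻x-up-to-meet       = at-i-gains
      ; x≻y-after-meet       = at-j-gains
      ; away-from-home       = λ q i<q q<j → contradiction (<j⇒≤i q<j) (<⇒≱ i<q)
      ; px≡meet+1+#movedLeft =
          trans j≡i+1 (sym (trans (cong (suc (pos i) +_) nobody-between) (+-identityʳ _)))
      }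
      where
      at-i-gains : ∀ q → pos i ≤ pos q → pos q ≤ pos i → home σ i ≤ pos q → P q (σ j) (σ i)
      at-i-gains q i≤q q≤i _ with refl ← pos-injective (≤-antisym q≤i i≤q) = i-gains
      at-j-gains : ∀ q → pos i < pos q → pos q ≤ pos j → pos q ≤ home σ j → P q (σ i) (σ j)
      at-j-gains q i<q q≤j _ with refl ← pos-injective (≤-antisym q≤j (i<⇒j≤ i<q)) = j-gains
      nobody-between : #movedLeft σ′ (pos i) (pos j) ≡ 0
      nobody-between = count-none (movedLeftBetween? σ′ (pos i) (pos j))
                                  λ q (i<q , q<j , _) → <⇒≱ i<q (<j⇒≤i q<j)

    advance-x : ∀ {hb} → Crossing σ (σ i) (σ hb) (pos i) (pos hb) → Crossing σ′ (σ i) (σ hb) (pos j) (pos hb)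
    advance-x {hb} C = record
      { meet                 = meet
      ; x-home≤meet          = x-home≤meet
      ; meet<px              = <-trans meet<px i<j
      ; py≤meet              = py≤meet
      ; meet<y-home          = meet<y-home
      ; y≻x-up-to-meet       = y≻x-up-to-meet
      ; x≻y-after-meet       = x≻y-after-meet′
      ; away-from-home       = λ q hb<q q<j → away-from-home′ q λ q≢i _ →
                                 away-from-home q hb<q (≤∧≢⇒< (<j⇒≤i q<j) (q≢i ∘ pos-injective))
      ; px≡meet+1+#movedLeft = begin
          pos j                                      ≡⟨ j≡i+1 ⟩
          suc (pos i)                                ≡⟨ cong suc px≡meet+1+#movedLeft ⟩
          suc (suc meet + #movedLeft σ (pos hb) (pos i)) ≡⟨ sym (+-suc (suc meet) _) ⟩
          suc meet + suc (#movedLeft σ (pos hb) (pos i)) ≡⟨ cong (suc meet +_) (sym x-passes-i) ⟩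
          suc meet + #movedLeft σ′ (pos hb) (pos j)  ∎
      }
      where
      open Crossing C
      open ≡-Reasoning
      hb<i : pos hb < pos i
      hb<i = ≤-<-trans py≤meet meet<px
      x≻y-after-meet′ : ∀ q → meet < pos q → pos q ≤ pos j → pos q ≤ home σ hb → P q (σ i) (σ hb)
      x≻y-after-meet′ q meet<q q≤j q≤y with m≤n⇒m<n∨m≡n q≤j
      ... | inj₁ q<j = x≻y-after-meet q meet<q (<j⇒≤i q<j) q≤y
      ... | inj₂ q≡j with refl ← pos-injective q≡j =
        ≻.trans j j-gains (current≻passed j hb (inj₂ (<-trans hb<i i<j , q≤y)))
      agree : ∀ q → q ≢ i →
              MovedLeftBetween σ (pos hb) (pos i) q ⇔ MovedLeftBetween σ′ (pos hb) (pos j) q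
      agree q q≢i with transposeView i j q
      ... | at-i _ = contradiction refl q≢i
      ... | at-j _ = both-false (λ (_ , j<i , _) → <-asym j<i i<j)
                                (λ (_ , _ , j<home) → <-asym j<home j-moved-right′)
      ... | away _ _ τq rewrite τq =
        mk⇔ (λ (hb<q , q<i , moved) → hb<q , <-trans q<i i<j , moved)
            (λ (hb<q , q<j , moved) → hb<q , ≤∧≢⇒< (<j⇒≤i q<j) (q≢i ∘ pos-injective) , moved)
      x-passes-i : #movedLeft σ′ (pos hb) (pos j) ≡ suc (#movedLeft σ (pos hb) (pos i))
      x-passes-i = count-insert (movedLeftBetween? σ (pos hb) (pos i))
                                (movedLeftBetween? σ′ (pos hb) (pos j)) i agree (λ (_ , i<i , _) → <-irrefl refl i<i) (hb<i , i<j , i-moved-left′)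

    advance-y : ∀ {ha} → Crossing σ (σ ha) (σ j) (pos ha) (pos j) → Crossing σ′ (σ ha) (σ j) (pos ha) (pos i)
    advance-y {ha} C = record
      { meet                 = meet
      ; x-home≤meet          = x-home≤meet
      ; meet<px              = meet<px
      ; py≤meet              = ≤-trans (<⇒≤ i<j) py≤meet
      ; meet<y-home          = meet<y-home
      ; y≻x-up-to-meet       = y≻x-up-to-meet′
      ; x≻y-after-meet       = x≻y-after-meet
      ; away-from-home       = λ q i<q q<ha → away-from-home′ q λ _ q≢j →
                                 away-from-home q (≤∧≢⇒< (i<⇒j≤ i<q) (q≢j ∘ pos-injective ∘ sym)) q<ha
      ; px≡meet+1+#movedLeft = trans px≡meet+1+#movedLeft (cong (suc meet +_) (count-cong _ _ agree))
      }
      where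
      open Crossing C
      y≻x-up-to-meet′ : ∀ q → pos i ≤ pos q → pos q ≤ meet → home σ ha ≤ pos q → P q (σ j) (σ ha)
      y≻x-up-to-meet′ q i≤q q≤meet x≤q with m≤n⇒m<n∨m≡n i≤q
      ... | inj₁ i<q = y≻x-up-to-meet q (i<⇒j≤ i<q) q≤meet x≤q
      ... | inj₂ i≡q with refl ← pos-injective (sym i≡q) =
        ≻.trans i i-gains (current≻passed i ha (inj₁ (x≤q , ≤-<-trans q≤meet meet<px)))
      agree : ∀ q → MovedLeftBetween σ (pos j) (pos ha) q ⇔ MovedLeftBetween σ′ (pos i) (pos ha) q
      agree q with transposeView i j q
      ... | at-i _ = both-false (λ (j<i , _) → <-asym j<i i<j) (λ (i<i , _) → <-irrefl refl i<i)
      ... | at-j _ = both-false (λ (j<j , _) → <-irrefl refl j<j)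
                                (λ (_ , _ , j<home) → <-asym j<home j-moved-right′)
      ... | away _ q≢j τq rewrite τq =
        mk⇔ (λ (j<q , rest) → <-trans i<j j<q , rest)
            (λ (i<q , rest) → ≤∧≢⇒< (i<⇒j≤ i<q) (q≢j ∘ pos-injective ∘ sym) , rest)

    unaffected : ∀ {ha hb} → ha ≢ j → hb ≢ i →
                 Crossing σ (σ ha) (σ hb) (pos ha) (pos hb) → Crossing σ′ (σ ha) (σ hb) (pos ha) (pos hb)
    unaffected {ha} {hb} ha≢j hb≢i C = record
      { Crossing C
      ; away-from-home       = λ q hb<q q<ha → away-from-home′ q λ _ _ → away-from-home q hb<q q<ha
      ; px≡meet+1+#movedLeft = trans px≡meet+1+#movedLeft
          (cong (suc meet +_) (count-transpose _ _ i j agree (both-false i-stays-put j-stays-put) j⇔i))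
      }
      where
      open Crossing C
      agree : ∀ q → q ≢ i → q ≢ j →
              MovedLeftBetween σ (pos hb) (pos ha) q ⇔ MovedLeftBetween σ′ (pos hb) (pos ha) q
      agree q q≢i q≢j rewrite transpose-other i j q≢i q≢j = Function.Properties.Equivalence.refl
      i-stays-put : ¬ MovedLeftBetween σ (pos hb) (pos ha) i
      i-stays-put (_ , _ , i<home) = <⇒≱ i<home i-home≤i
      j-stays-put : ¬ MovedLeftBetween σ′ (pos hb) (pos ha) j
      j-stays-put (_ , _ , j<home) = <-asym j<home j-moved-right′
      j⇔i : MovedLeftBetween σ (pos hb) (pos ha) j ⇔ MovedLeftBetween σ′ (pos hb) (pos ha) i
      j⇔i = mk⇔
        (λ (hb<j , j<ha , _) → ≤∧≢⇒< (<j⇒≤i hb<j) (hb≢i ∘ pos-injective) , <-trans i<j j<ha , i-moved-left′)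
        (λ (hb<i , i<ha , _) →
           j-moved-left (<-trans hb<i i<j) (≤∧≢⇒< (i<⇒j≤ i<ha) (ha≢j ∘ pos-injective ∘ sym)))
        where
        j-moved-left : pos hb < pos j → pos j < pos ha → MovedLeftBetween σ (pos hb) (pos ha) j
        j-moved-left hb<j j<ha = hb<j , j<ha , ≤∧≢⇒< j≤j-home (away-from-home j hb<j j<ha)

    crossing′ : ∀ ha hb → home σ′ ha < home σ′ hb → pos hb < pos ha →
                Crossing σ′ (σ′ ha) (σ′ hb) (pos ha) (pos hb)
    crossing′ ha hb home< b<a with τ-preserves-< b<a
    ... | inj₁ (refl , refl) rewrite transpose-matchˡ i j | transpose-matchʳ i j = new-crossing
    ... | inj₂ τb<τa with transposeView i j ha | transposeView i j hb
    ...   | at-i τi | _ rewrite τi =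
      contradiction (proj₁ (crossing-directions (crossing j (τ hb) home< τb<τa))) (≤⇒≯ j≤j-home)
    ...   | _ | at-j τj rewrite τj =
      contradiction (proj₂ (crossing-directions (crossing (τ ha) i home< τb<τa))) (≤⇒≯ i-home≤i)
    ...   | at-j τj | at-i τi rewrite τj | τi = contradiction τb<τa (<-asym i<j)
    ...   | at-j τj | away _ _ τb rewrite τj | τb = advance-x (crossing i hb home< τb<τa)
    ...   | away _ _ τa | at-i τi rewrite τa | τi = advance-y (crossing ha j home< τb<τa)
    ...   | away _ ha≢j τa | away hb≢i _ τb rewrite τa | τb =
      unaffected ha≢j hb≢i (crossing ha hb home< τb<τa)

    invariant′ : Invariant σ′
    invariant′ = record
      { current≻passed   = current≻passed′
      ; follower≻leaderʳ = follower≻leaderʳ′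
      ; follower≻leaderˡ = follower≻leaderˡ′
      ; crossing         = crossing′
      }

  reachable⇒invariant : ∀ {σ} → Reachable P σ → Invariant σ
  reachable⇒invariant (init σ σ≗σ₀) = invariant-resp-≗ (sym ∘ σ≗σ₀) initial-invariant
  reachable⇒invariant (step σ σ′ reachable i j j≡i+1 i-gains j-gains σ′≗swap) =
    invariant-resp-≗ (λ x → sym (trans (σ′≗swap x) (swap≗transpose σ i j x)))
                     (Step.invariant′ (reachable⇒invariant reachable) (cong suc j≡i+1) i-gains j-gains)

  module _ {σ : Assignment n} (inv : Invariant σ) where

    open Invariant inv

    left-of-o₁-moved-left : ∀ {h₁ h} → home σ h₁ ≡ 1 → pos h < pos h₁ → MovedLeft σ h
    left-of-o₁-moved-left {h₁} {h} h₁-home≡1 h<h₁ with home σ h ≟ 1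
    ... | yes h-home≡1 = ⊥-elim (≻.irrefl h (pos-injective (trans h-home≡1 (sym h₁-home≡1)))
                                   (current≻passed h h₁ (inj₁ (h₁-home≤h , h<h₁))))
      where
      h₁-home≤h : home σ h₁ ≤ pos h
      h₁-home≤h = subst (_≤ pos h) (sym h₁-home≡1) (s≤s z≤n)
    ... | no h-home≢1 = proj₂ (crossing-directions (crossing h₁ h h₁-home<h-home h<h₁))
      where
      h₁-home<h-home : home σ h₁ < home σ h
      h₁-home<h-home = subst (_< home σ h) (sym h₁-home≡1) (≤∧≢⇒< (s≤s z≤n) (h-home≢1 ∘ sym))

    right-of-oₙ-moved-right : ∀ {hₙ h} → home σ hₙ ≡ n → pos hₙ < pos h → MovedRight σ h
    right-of-oₙ-moved-right {hₙ} {h} hₙ-home≡n hₙ<h with home σ h ≟ n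
    ... | yes h-home≡n = ⊥-elim (≻.irrefl h (pos-injective (trans h-home≡n (sym hₙ-home≡n)))
                                   (current≻passed h hₙ (inj₂ (hₙ<h , h≤hₙ-home))))
      where
      h≤hₙ-home : pos h ≤ home σ hₙ
      h≤hₙ-home = subst (pos h ≤_) (sym hₙ-home≡n) (toℕ<n h)
    ... | no h-home≢n = proj₁ (crossing-directions (crossing h hₙ h-home<hₙ-home hₙ<h))
      where
      h-home<hₙ-home : home σ h < home σ hₙ
      h-home<hₙ-home = subst (home σ h <_) (sym hₙ-home≡n) (≤∧≢⇒< (toℕ<n (σ h)) h-home≢n)

    module _ (k : ℕ) {ha hb : Fin n} (a<b : home σ ha < home σ hb) where

      private
        distinct-holders : pos ha ≢ pos hb
        distinct-holders a′≡b′ = <⇒≢ a<b (cong (home σ) (pos-injective a′≡b′))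

      leftward-pair-compatible : MovedLeft σ ha → MovedLeft σ hb → PairCompatible P k (σ ha) (σ hb) ha hb
      leftward-pair-compatible a-left b-left with <-cmp (pos ha) (pos hb)
      ... | tri< a′<b′ _ _ = inj₂ (inj₂ (inj₁ (a-left , b-left , a′<b′ , λ q (q∈a , q∈b) →
              follower≻leaderˡ ha hb q a<b a′<b′ (proj₁ (∈[]-boundsᵒ (<⇒≤ b-left) q∈b))
                                                 (proj₂ (∈[]-boundsᵒ (<⇒≤ a-left) q∈a)))))
      ... | tri≈ _ a′≡b′ _ = contradiction a′≡b′ distinct-holders
      ... | tri> _ _ b′<a′ =
        contradiction (proj₁ (crossing-directions (crossing ha hb a<b b′<a′))) (<⇒≯ a-left)

      rightward-pair-compatible : MovedRight σ ha → MovedRight σ hb → PairCompatible P k (σ ha) (σ hb) ha hb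
      rightward-pair-compatible a-right b-right with <-cmp (pos ha) (pos hb)
      ... | tri< a′<b′ _ _ = inj₂ (inj₁ (a-right , b-right , a′<b′ , λ q (q∈a , q∈b) →
              follower≻leaderʳ ha hb q a<b a′<b′ (proj₁ (∈[]-bounds (<⇒≤ b-right) q∈b))
                                                 (proj₂ (∈[]-bounds (<⇒≤ a-right) q∈a))))
      ... | tri≈ _ a′≡b′ _ = contradiction a′≡b′ distinct-holders
      ... | tri> _ _ b′<a′ =
        contradiction (proj₂ (crossing-directions (crossing ha hb a<b b′<a′))) (<⇒≯ b-right)

      diverging-pair-compatible : MovedLeft σ ha → MovedRight σ hb → PairCompatible P k (σ ha) (σ hb) ha hb
      diverging-pair-compatible a-left b-right = inj₁ λ (q , q∈a , q∈b) →
        <⇒≱ a<b (≤-trans (proj₁ (∈[]-bounds (<⇒≤ b-right) q∈b)) (proj₂ (∈[]-boundsᵒ (<⇒≤ a-left) q∈a)))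

      crossing-pair-compatible : pos hb < pos ha → suc (pos hb + #movedLeft σ (pos hb) (pos ha)) ≡ k →
                                 PairCompatible P k (σ ha) (σ hb) ha hb
      crossing-pair-compatible b′<a′ k≡ =
        inj₂ (inj₂ (inj₂ (a<a′ , b′<b , c∈Q , c≢a , y≻x-before-c , x≻y-from-c)))
        where
        a′ b′ : ℕ
        a′ = pos ha
        b′ = pos hb
        C : Crossing σ (σ ha) (σ hb) a′ b′
        C = crossing ha hb a<b b′<a′
        open Crossing C
        a<a′ : home σ ha < a′
        a<a′ = proj₁ (crossing-directions C)
        b′<b : b′ < home σ hb
        b′<b = proj₂ (crossing-directions C)
        c≡meet+1 : (a′ + b′ + 1) ∸ k ≡ suc meet
        c≡meet+1 = begin
          (a′ + b′ + 1) ∸ k                            ≡⟨ cong (λ x → (x + b′ + 1) ∸ k) px≡meet+1+#movedLeft ⟩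
          (suc meet + #movedLeft σ b′ a′ + b′ + 1) ∸ k ≡⟨ cong (_∸ k) (x+m+b+1≡x+[1+b+m] (suc meet) _ b′) ⟩
          (suc meet + suc (b′ + #movedLeft σ b′ a′)) ∸ k ≡⟨ cong (λ x → (suc meet + x) ∸ k) k≡ ⟩
          (suc meet + k) ∸ k                           ≡⟨ m+n∸n≡m (suc meet) k ⟩
          suc meet                                     ∎
          where open ≡-Reasoning
        c∈Q : InQ (home σ ha) a′ (home σ hb) b′ ((a′ + b′ + 1) ∸ k)
        c∈Q rewrite c≡meet+1 =
          inj₁ (m≤n⇒m≤1+n x-home≤meet , meet<px) , inj₂ (m≤n⇒m≤1+n py≤meet , meet<y-home)
        c≢a : (a′ + b′ + 1) ∸ k ≢ home σ ha
        c≢a c≡a = <⇒≱ (subst (meet <_) (trans (sym c≡meet+1) c≡a) (n<1+n meet)) x-home≤meet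
        y≻x-before-c : ∀ q → home σ ha ⊔ b′ ≤ pos q → pos q < (a′ + b′ + 1) ∸ k → P q (σ hb) (σ ha)
        y≻x-before-c q ≤q q<c = y≻x-up-to-meet q (≤-trans (m≤n⊔m (home σ ha) b′) ≤q)
                                                  (s≤s⁻¹ (subst (pos q <_) c≡meet+1 q<c))
                                                  (≤-trans (m≤m⊔n (home σ ha) b′) ≤q)
        x≻y-from-c : ∀ q → (a′ + b′ + 1) ∸ k ≤ pos q → pos q ≤ a′ ⊓ home σ hb → P q (σ ha) (σ hb)
        x≻y-from-c q c≤q q≤ = x≻y-after-meet q (subst (_≤ pos q) c≡meet+1 c≤q)
                                                (≤-trans q≤ (m⊓n≤m a′ (home σ hb)))
                                                (≤-trans q≤ (m⊓n≤n a′ (home σ hb)))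

    #movedLeft-across : ∀ {k} → SplitAt σ k → ∀ {ha hb : Fin n} → pos hb < k → k ≤ pos ha →
                        suc (pos hb + #movedLeft σ (pos hb) (pos ha)) ≡ k
    #movedLeft-across {suc k′} (moved-left , moved-right) {ha} {hb} (s≤s b′≤k′) k≤a′ = cong suc (begin
      pos hb + #movedLeft σ (pos hb) (pos ha)       ≡⟨ cong (pos hb +_) (count-cong _ _ left-of-k) ⟩
      pos hb + count (in-interval? {n} (pos hb) k′) ≡⟨ cong (pos hb +_) (count-interval n (pos hb) k′ k′≤n) ⟩
      pos hb + (k′ ∸ pos hb)                        ≡⟨ m+[n∸m]≡n b′≤k′ ⟩
      k′                                            ∎)
      where
      open ≡-Reasoning
      k′≤n : k′ ≤ n
      k′≤n = ≤-trans (≤-trans (n≤1+n k′) k≤a′) (toℕ<n ha)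
      left-of-k : ∀ q → MovedLeftBetween σ (pos hb) (pos ha) q ⇔ (pos hb < pos q × pos q ≤ k′)
      left-of-k q = mk⇔
        (λ (b′<q , _ , q-left) → b′<q , s≤s⁻¹ (≰⇒> λ k≤q → <-asym q-left (moved-right q k≤q)))
        (λ (b′<q , q≤k′) → b′<q , <-≤-trans (s≤s q≤k′) k≤a′ , moved-left q (s≤s q≤k′))

    split-compatible : ∀ {k} → SplitAt σ k → Compatible P k σ
    split-compatible {k} split@(moved-left , moved-right) = never-home , pairs
      where
      never-home : ∀ i → σ i ≢ i
      never-home i σi≡i with pos i <? k
      ... | yes i<k = <-irrefl (cong pos (sym σi≡i)) (moved-left i i<k)
      ... | no i≮k = <-irrefl (cong pos σi≡i) (moved-right i (≮⇒≥ i≮k))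
      pairs : ∀ ha hb → home σ ha < home σ hb → PairCompatible P k (σ ha) (σ hb) ha hb
      pairs ha hb a<b with pos ha <? k | pos hb <? k
      ... | yes a′<k | yes b′<k = leftward-pair-compatible k a<b (moved-left ha a′<k) (moved-left hb b′<k)
      ... | no a′≮k | no b′≮k =
        rightward-pair-compatible k a<b (moved-right ha (≮⇒≥ a′≮k)) (moved-right hb (≮⇒≥ b′≮k))
      ... | yes a′<k | no b′≮k = diverging-pair-compatible k a<b (moved-left ha a′<k) (moved-right hb (≮⇒≥ b′≮k))
      ... | no a′≮k | yes b′<k = crossing-pair-compatible k a<b (<-≤-trans b′<k k≤a′)
                                                            (#movedLeft-across split b′<k k≤a′)
        where
        k≤a′ : k ≤ pos ha
        k≤a′ = ≮⇒≥ a′≮k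

lemma9 : (n k : ℕ) → 2 ≤ k → k ≤ n →
         (P : Profile n) → IsLinearProfile P →
         (σ : Assignment n) → Reachable P σ →
         ((i : Fin n) → pos i ≡ k → pos (σ i) ≡ 1) →
         ((i : Fin n) → pos i ≡ k ∸ 1 → pos (σ i) ≡ n) →
         Compatible P k σ
lemma9 n (suc (suc k₂)) (s≤s (s≤s z≤n)) k≤n P linear σ reachable o₁-at-k oₙ-at-k-1 =
  split-compatible P linear inv (left-of-k , right-of-k)
  where
  inv : Invariant P linear σ
  inv = reachable⇒invariant P linear reachable
  hₖ hₖ₋₁ : Fin n
  hₖ = fromℕ< k≤n
  hₖ₋₁ = fromℕ< (<⇒≤ k≤n)
  hₖ-pos : pos hₖ ≡ suc (suc k₂)
  hₖ-pos = cong suc (toℕ-fromℕ< k≤n)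
  hₖ₋₁-pos : pos hₖ₋₁ ≡ suc k₂
  hₖ₋₁-pos = cong suc (toℕ-fromℕ< (<⇒≤ k≤n))
  left-of-k : ∀ h → pos h < suc (suc k₂) → MovedLeft σ h
  left-of-k h h<k = left-of-o₁-moved-left P linear inv (o₁-at-k hₖ hₖ-pos) (subst (pos h <_) (sym hₖ-pos) h<k)
  right-of-k : ∀ h → suc (suc k₂) ≤ pos h → MovedRight σ h
  right-of-k h k≤h =
    right-of-oₙ-moved-right P linear inv (oₙ-at-k-1 hₖ₋₁ hₖ₋₁-pos) (subst (_< pos h) (sym hₖ₋₁-pos) k≤h)
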